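{- The class $\mathcal K$ of all finite metric spaces is a strong locally finite subclass of the class $\mathcal R$ of all finite $\mathbb R^{>0}$-edge-labelled graphs.
   Context: Let $L$ be the relational language with a binary relation symbol $R_s$ for each $s\in\mathbb R^{>0}$. An $\mathbb R^{>0}$-edge-labelled graph is an $L$-structure in which each $R_s$ is symmetric and irreflexive and each pair of vertices lies in at most one relation (an edge with label $s$). A metric space is identified with the complete edge-labelled graph where the pair $\{x,y\}$ has label $d(x,y)$. Homomorphisms preserve relations; embeddings are injective homomorphisms with homomorphic inverse; an $L$-structure is irreducible if any two of its vertices lie together in a tuple of some relation; a homomorphism-embedding is a homomorphism which restricts to an embedding on each irreducible substructure. $\mathbf C'$ is a completion of $\mathbf C$ if there is a homomorphism-embedding $\mathbf C\to\mathbf C'$, strong if it can be taken injective. $\mathcal K\subseteq\mathcal R$ is a locally finite subclass of $\mathcal R$ if for every $\mathbf B\in\mathcal K$ and $\mathbf C_0\in\mathcal R$ there is an integer $n=n(\mathbf B,\mathbf C_0)$ such that every finite $L$-structure $\mathbf C$ has a completion $\mathbf C'\in\mathcal K$ provided: (i) every irreducible substructure $\mathbf D\subseteq\mathbf C$ satisfies $D\subseteq f[B]$ for some embedding $f\colon\mathbf B\to\mathbf C$; (ii) there is a homomorphism-embedding $\mathbf C\to\mathbf C_0$; (iii) every substructure of $\mathbf C$ on at most $n$ vertices has a completion in $\mathcal K$. It is strong if moreover $\mathbf C'$ can always be taken to be a strong completion. -}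

module Defs where

open import Level using (0ℓ)
open import Data.Nat using (ℕ) renaming (_≤_ to _≤ℕ_)
open import Data.Fin using (Fin)
open import Data.Product using (Σ; ∃; _×_; _,_)
open import Data.Sum using (_⊎_)
open import Relation.Binary.PropositionalEquality using (_≡_; _≢_)
open import Relation.Nullary using (¬_)
open import Algebra.Structures using (IsCommutativeRing)
open import Relation.Binary.Structures using (IsStrictTotalOrder)
open import Function.Definitions using (Injective)

-- The real numbers, axiomatised as a complete ordered field
-- (unique up to isomorphism, so quantifying over all models is faithful).
record RealField : Set₁ where
  infixl 6 _+_
  infixl 7 _*_
  infix 4 _<_
  field
    ℝ : Set
    _+_ _*_ : ℝ → ℝ → ℝ
    -_ : ℝ → ℝ
    0ℝ 1ℝ : ℝ
    _<_ : ℝ → ℝ → Set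
    isCommutativeRing : IsCommutativeRing _≡_ _+_ _*_ -_ 0ℝ 1ℝ
    0≢1 : 0ℝ ≢ 1ℝ
    inverse : ∀ x → x ≢ 0ℝ → ∃ λ y → x * y ≡ 1ℝ
    isStrictTotalOrder : IsStrictTotalOrder _≡_ _<_
    +-mono-< : ∀ {x y} z → x < y → x + z < y + z
    *-pos : ∀ {x y} → 0ℝ < x → 0ℝ < y → 0ℝ < x * y
    sup : (P : ℝ → Set) → ∃ P →
          (∃ λ b → ∀ x → P x → (x < b ⊎ x ≡ b)) →
          ∃ λ s → (∀ x → P x → (x < s ⊎ x ≡ s))
                × (∀ b → (∀ x → P x → (x < b ⊎ x ≡ b)) → (s < b ⊎ s ≡ b))

module Structures (RF : RealField) where
  open RealField RF

  infix 4 _≤_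
  _≤_ : ℝ → ℝ → Set
  x ≤ y = x < y ⊎ x ≡ y

  -- A finite L-structure: vertex set Fin size, and a binary relation R_s for
  -- each label s.  Only positive labels are symbols of L, so R_s is required
  -- to be empty unless 0 < s.
  record Str : Set₁ where
    constructor mkStr
    field
      size : ℕ
      rel : ℝ → Fin size → Fin size → Set
      rel-pos : ∀ {s x y} → rel s x y → 0ℝ < s
  open Str public

  IsEdgeLabelled : Str → Set
  IsEdgeLabelled A =
      (∀ {s x y} → rel A s x y → rel A s y x)
    × (∀ {s x} → ¬ rel A s x x)
    × (∀ {s t x y} → rel A s x y → rel A t x y → s ≡ t)

  IsMetric : Str → Set
  IsMetric A =
      IsEdgeLabelled A
    × (∀ x y → x ≢ y → ∃ λ s → rel A s x y)
    × (∀ {a b c x y z} → rel A a x y → rel A b y z → rel A c x z → c ≤ a + b)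

  IsHom : (A B : Str) → (Fin (size A) → Fin (size B)) → Set
  IsHom A B f = ∀ {s x y} → rel A s x y → rel B s (f x) (f y)

  IsEmb : (A B : Str) → (Fin (size A) → Fin (size B)) → Set
  IsEmb A B f = Injective _≡_ _≡_ f × IsHom A B f
              × (∀ {s x y} → rel B s (f x) (f y) → rel A s x y)

  Irreducible : (A : Str) → (Fin (size A) → Set) → Set
  Irreducible A D = ∀ x y → D x → D y → x ≢ y →
                    ∃ λ s → rel A s x y ⊎ rel A s y x

  IsHomEmb : (A B : Str) → (Fin (size A) → Fin (size B)) → Set₁
  IsHomEmb A B f = IsHom A B f
    × (∀ (D : Fin (size A) → Set) → Irreducible A D →
         (∀ x y → D x → D y → f x ≡ f y → x ≡ y)
       × (∀ {s x y} → D x → D y → rel B s (f x) (f y) → rel A s x y))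

  Completion : Str → Str → Set₁
  Completion A A' = ∃ λ f → IsHomEmb A A' f

  StrongCompletion : Str → Str → Set₁
  StrongCompletion A A' = ∃ λ f → IsHomEmb A A' f × Injective _≡_ _≡_ f

  Induced : (A : Str) {k : ℕ} → (Fin k → Fin (size A)) → Str
  Induced A {k} ι = mkStr k (λ s i j → rel A s (ι i) (ι j)) (rel-pos A)

  StrongLocallyFiniteSubclass : (K R : Str → Set) → Set₁
  StrongLocallyFiniteSubclass K R =
      (∀ A → K A → R A)
    × (∀ B → K B → ∀ C₀ → R C₀ → ∃ λ (n : ℕ) → ∀ (C : Str) →
        -- (i)
        (∀ (D : Fin (size C) → Set) → Irreducible C D →
           ∃ λ f → IsEmb B C f × (∀ x → D x → ∃ λ b → f b ≡ x)) →
        -- (ii)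
        (∃ λ g → IsHomEmb C C₀ g) →
        -- (iii)
        (∀ k (ι : Fin k → Fin (size C)) → Injective _≡_ _≡_ ι → k ≤ℕ n →
           Σ Str λ C' → K C' × Completion (Induced C ι) C') →
        Σ Str λ C' → K C' × StrongCompletion C C')

-- The finitely many labels of B lie in an interval [m, M] with m > 0; take n with n·m ≥ M.
-- If C satisfies (i)–(iii) for this n, then (i) puts its labels in [m, M], (ii) makes it symmetric
-- and irreflexive, and every edge of label a between x and y is at most the weight of any walk
-- from x to y: a walk with at least n steps weighs at least n·m ≥ M ≥ a, and a shorter walk lies in
-- a substructure on at most n vertices, where the triangle inequality of its metric completion
-- gives the bound. Hence the shortest-walk distance of C, with every pair of vertices additionally
-- joined at distance M, is a metric extending the labels of C, and the identity map is a strong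
-- completion.

module Submission where

open import Defs
open import Level using (0ℓ)
open import Axiom.ExcludedMiddle using (ExcludedMiddle)
open import Data.Nat using (ℕ; zero; suc; z≤n; s≤s) renaming (_≤_ to _≤ℕ_; _<_ to _<ℕ_)
import Data.Nat.Properties as ℕ
open import Data.Fin using (Fin; zero; suc)
import Data.Fin.Properties as Fin
open import Data.Product using (Σ; ∃; ∃₂; _×_; _,_; proj₁; proj₂)
open import Data.Sum using (_⊎_; inj₁; inj₂; [_,_]′)
open import Data.List as List using (List; []; _∷_; lookup; deduplicate)
open import Data.List.Membership.Propositional using (_∈_)
open import Data.List.Membership.Propositional.Properties using (∈-lookup; ∈-deduplicate⁺)
open import Data.List.Properties using (length-deduplicate)
open import Data.List.Relation.Unary.Any using (here; there; index)
open import Data.List.Relation.Unary.Any.Properties using (lookup-index)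
import Data.List.Relation.Unary.All as All
open import Data.List.Relation.Unary.AllPairs using (_∷_)
open import Data.List.Relation.Unary.Unique.Propositional using (Unique)
open import Data.List.Relation.Unary.Unique.DecPropositional.Properties using (deduplicate-!)
open import Function.Definitions using (Injective)
open import Relation.Binary.Bundles using (StrictTotalOrder)
open import Relation.Binary.Definitions using (tri<; tri≈; tri>)
open import Relation.Binary.PropositionalEquality
  using (_≡_; _≢_; refl; sym; trans; cong; cong₂; subst; subst₂; module ≡-Reasoning)
open import Function using (_∘_)
open import Relation.Nullary using (¬_; yes; no; contradiction)
open import Algebra.Structures using (IsCommutativeRing)

lookup-injective : ∀ {A : Set} {xs : List A} → Unique xs → Injective _≡_ _≡_ (lookup xs)
lookup-injective {xs = _ ∷ _} _          {zero}  {zero}  _  = refl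
lookup-injective {xs = _ ∷ _} (x∉ ∷ _)   {zero}  {suc j} eq = contradiction eq       (All.lookup x∉ (∈-lookup j))
lookup-injective {xs = _ ∷ _} (x∉ ∷ _)   {suc i} {zero}  eq = contradiction (sym eq) (All.lookup x∉ (∈-lookup i))
lookup-injective {xs = _ ∷ _} (_ ∷ uniq) {suc i} {suc j} eq = cong suc (lookup-injective uniq eq)

module OrderedField (RF : RealField) where
  open RealField RF public
  open Structures RF using (_≤_)
  open IsCommutativeRing isCommutativeRing public
    using (+-assoc; +-comm; +-identityˡ; +-identityʳ; -‿inverseˡ; -‿inverseʳ)

  strictTotalOrder : StrictTotalOrder 0ℓ 0ℓ 0ℓ
  strictTotalOrder = record { isStrictTotalOrder = isStrictTotalOrder }

  open StrictTotalOrder strictTotalOrder public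
    using (compare; strictPartialOrder) renaming (trans to <-trans; irrefl to <-irrefl)
  open import Relation.Binary.Properties.StrictTotalOrder strictTotalOrder public
    using (totalOrder) renaming (refl to ≤-refl; trans to ≤-trans; antisym to ≤-antisym)

  <-≤-trans : ∀ {x y z} → x < y → y ≤ z → x < z
  <-≤-trans x<y (inj₁ y<z)  = <-trans x<y y<z
  <-≤-trans x<y (inj₂ refl) = x<y

  <⇒≱ : ∀ {x y} → x < y → ¬ y ≤ x
  <⇒≱ x<y y≤x = <-irrefl refl (<-≤-trans x<y y≤x)

  ≰⇒> : ∀ {x y} → ¬ x ≤ y → y < x
  ≰⇒> {x} {y} x≰y with compare x y
  ... | tri< x<y _ _ = contradiction (inj₁ x<y) x≰y
  ... | tri≈ _ x≡y _ = contradiction (inj₂ x≡y) x≰y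
  ... | tri> _ _ y<x = y<x

  +-monoˡ-< : ∀ {x y} z → x < y → z + x < z + y
  +-monoˡ-< {x} {y} z x<y = subst₂ _<_ (+-comm x z) (+-comm y z) (+-mono-< z x<y)

  +-monoʳ-≤ : ∀ {x y} z → x ≤ y → x + z ≤ y + z
  +-monoʳ-≤ z (inj₁ x<y)  = inj₁ (+-mono-< z x<y)
  +-monoʳ-≤ z (inj₂ refl) = ≤-refl

  +-monoˡ-≤ : ∀ {x y} z → x ≤ y → z + x ≤ z + y
  +-monoˡ-≤ {x} {y} z x≤y = subst₂ _≤_ (+-comm x z) (+-comm y z) (+-monoʳ-≤ z x≤y)

  +-mono-≤ : ∀ {a b c d} → a ≤ b → c ≤ d → a + c ≤ b + d
  +-mono-≤ {b = b} {c} a≤b c≤d = ≤-trans (+-monoʳ-≤ c a≤b) (+-monoˡ-≤ b c≤d)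

  x≤x+y : ∀ {x y} → 0ℝ ≤ y → x ≤ x + y
  x≤x+y {x} {y} 0≤y = subst (_≤ x + y) (+-identityʳ x) (+-monoˡ-≤ x 0≤y)

  x<x+y : ∀ {x y} → 0ℝ < y → x < x + y
  x<x+y {x} {y} 0<y = subst (_< x + y) (+-identityʳ x) (+-monoˡ-< x 0<y)

  y≤x+y : ∀ {x y} → 0ℝ ≤ x → y ≤ x + y
  y≤x+y {x} {y} 0≤x = subst (y ≤_) (+-comm y x) (x≤x+y 0≤x)

  infixl 6 _-_
  _-_ : ℝ → ℝ → ℝ
  x - y = x + - y

  x+y-y≡x : ∀ x y → x + y - y ≡ x
  x+y-y≡x x y = begin
    x + y - y     ≡⟨ +-assoc x y (- y) ⟩
    x + (y - y)   ≡⟨ cong (x +_) (-‿inverseʳ y) ⟩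
    x + 0ℝ        ≡⟨ +-identityʳ x ⟩
    x             ∎
    where open ≡-Reasoning

  x-y+y≡x : ∀ x y → x - y + y ≡ x
  x-y+y≡x x y = begin
    x - y + y       ≡⟨ +-assoc x (- y) y ⟩
    x + (- y + y)   ≡⟨ cong (x +_) (-‿inverseˡ y) ⟩
    x + 0ℝ          ≡⟨ +-identityʳ x ⟩
    x               ∎
    where open ≡-Reasoning

  x≤y+z⇒x-z≤y : ∀ {x y z} → x ≤ y + z → x - z ≤ y
  x≤y+z⇒x-z≤y {x} {y} {z} p = subst (x - z ≤_) (x+y-y≡x y z) (+-monoʳ-≤ (- z) p)

  x-z≤y⇒x≤y+z : ∀ {x y z} → x - z ≤ y → x ≤ y + z
  x-z≤y⇒x≤y+z {x} {y} {z} p = subst (_≤ y + z) (x-y+y≡x x z) (+-monoʳ-≤ z p)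

  x+z≤y⇒x≤y-z : ∀ {x y z} → x + z ≤ y → x ≤ y - z
  x+z≤y⇒x≤y-z {x} {y} {z} p = subst (_≤ y - z) (x+y-y≡x x z) (+-monoʳ-≤ (- z) p)

  x≤y-z⇒x+z≤y : ∀ {x y z} → x ≤ y - z → x + z ≤ y
  x≤y-z⇒x+z≤y {x} {y} {z} p = subst (x + z ≤_) (x-y+y≡x y z) (+-monoʳ-≤ z p)

  positive : ∃ (0ℝ <_)
  positive with compare 0ℝ 1ℝ
  ... | tri< 0<1 _ _ = 1ℝ , 0<1
  ... | tri≈ _ 0≡1 _ = contradiction 0≡1 0≢1
  ... | tri> _ _ 1<0 = - 1ℝ , subst₂ _<_ (-‿inverseʳ 1ℝ) (+-identityˡ (- 1ℝ)) (+-mono-< (- 1ℝ) 1<0)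

  infixr 7 _·_
  _·_ : ℕ → ℝ → ℝ
  zero  · x = 0ℝ
  suc n · x = x + n · x

  ·-nonneg : ∀ n {x} → 0ℝ ≤ x → 0ℝ ≤ n · x
  ·-nonneg zero    0≤x = ≤-refl
  ·-nonneg (suc n) 0≤x = ≤-trans 0≤x (x≤x+y (·-nonneg n 0≤x))

  ·-monoˡ-≤ : ∀ {m n x} → 0ℝ ≤ x → m ≤ℕ n → m · x ≤ n · x
  ·-monoˡ-≤ {n = n} 0≤x z≤n = ·-nonneg n 0≤x
  ·-monoˡ-≤ {x = x} 0≤x (s≤s m≤n) = +-monoˡ-≤ x (·-monoˡ-≤ 0≤x m≤n)

  archimedean : ExcludedMiddle 0ℓ → ∀ {x} y → 0ℝ < x → ∃ λ n → y ≤ n · x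
  archimedean em {x} y 0<x with em {∃ λ n → y ≤ n · x}
  ... | yes found = found
  ... | no none = contradiction s+x≤s (<⇒≱ (x<x+y 0<x))
    where
    S = sup (λ z → ∃ λ n → z ≡ n · x) (0ℝ , zero , refl)
            (y , λ { _ (n , refl) → inj₁ (≰⇒> λ y≤n·x → none (n , y≤n·x)) })
    s = proj₁ S
    -- s - x bounds every multiple n · x, because s bounds (suc n) · x
    s≤s-x : s ≤ s - x
    s≤s-x = proj₂ (proj₂ S) (s - x) λ { _ (n , refl) →
      x+z≤y⇒x≤y-z (subst (_≤ s) (+-comm x (n · x)) (proj₁ (proj₂ S) _ (suc n , refl))) }
    s+x≤s : s + x ≤ s
    s+x≤s = x≤y-z⇒x+z≤y s≤s-x

  IsInfimum : {I : Set} → (I → ℝ) → ℝ → Set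
  IsInfimum f z = (∀ i → z ≤ f i) × (∀ b → (∀ i → b ≤ f i) → b ≤ z)

  infimum : {I : Set} (f : I → ℝ) → (∃ λ b → ∀ i → b ≤ f i) → I → ∃ (IsInfimum f)
  infimum f bounded i = s , (λ j → proj₂ (proj₂ S) (f j) λ _ z≤f → z≤f j) , proj₁ (proj₂ S)
    where
    S = sup (λ z → ∀ i → z ≤ f i) bounded (f i , λ _ z≤f → z≤f i)
    s = proj₁ S

  infimum-+ : ∀ {I J : Set} {f : I → ℝ} {g : J → ℝ} {a b z} → IsInfimum f a → IsInfimum g b →
              (∀ i j → z ≤ f i + g j) → z ≤ a + b
  infimum-+ {f = f} {g} {a} {b} {z} (_ , a-glb) (_ , b-glb) z≤f+g =
    subst (z ≤_) (+-comm b a) (x-z≤y⇒x≤y+z (b-glb (z - a) z-a≤g))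
    where
    z-a≤g : ∀ j → z - a ≤ g j
    z-a≤g j = x≤y+z⇒x-z≤y (subst (z ≤_) (+-comm a (g j))
                (x-z≤y⇒x≤y+z (a-glb (z - g j) λ i → x≤y+z⇒x-z≤y (z≤f+g i j))))

  record Bounds (Q : ℝ → Set) : Set where
    field
      lower upper : ℝ
      lower-pos   : 0ℝ < lower
      lower≤upper : lower ≤ upper
      within      : ∀ {s} → Q s → lower ≤ s × s ≤ upper

  open import Algebra.Construct.NaturalChoice.Min totalOrder
    using (_⊓_; ⊓-sel; x⊓y≤x; x≤y⇒x⊓z≤y; x≤y⇒z⊓x≤y)
  open import Algebra.Construct.NaturalChoice.Max totalOrder
    using (_⊔_; x≤y⇒x≤y⊔z; x≤y⇒x≤z⊔y)

  bounds-⊆ : ∀ {P Q} → (∀ {s} → Q s → P s) → Bounds P → Bounds Q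
  bounds-⊆ Q⊆P b = record { Bounds b; within = λ q → Bounds.within b (Q⊆P q) }

  bounds-∅ : ∀ {Q} → (∀ {s} → ¬ Q s) → Bounds Q
  bounds-∅ Q-empty = record
    { lower = proj₁ positive ; upper = proj₁ positive ; lower-pos = proj₂ positive
    ; lower≤upper = ≤-refl ; within = λ q → contradiction q Q-empty }

  bounds-singleton : ∀ {Q t} → 0ℝ < t → (∀ {s} → Q s → s ≡ t) → Bounds Q
  bounds-singleton {t = t} 0<t Q⊆t = record
    { lower = t ; upper = t ; lower-pos = 0<t ; lower≤upper = ≤-refl
    ; within = λ q → inj₂ (sym (Q⊆t q)) , inj₂ (Q⊆t q) }

  bounds-∪ : ∀ {P Q} → Bounds P → Bounds Q → Bounds (λ s → P s ⊎ Q s)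
  bounds-∪ p q = record
    { lower = P.lower ⊓ Q.lower
    ; upper = P.upper ⊔ Q.upper
    ; lower-pos = [ (λ eq → subst (0ℝ <_) (sym eq) P.lower-pos)
                  , (λ eq → subst (0ℝ <_) (sym eq) Q.lower-pos) ]′ (⊓-sel P.lower Q.lower)
    ; lower≤upper = ≤-trans (x⊓y≤x P.lower Q.lower) (x≤y⇒x≤y⊔z Q.upper P.lower≤upper)
    ; within = [ (λ s∈P → x≤y⇒x⊓z≤y Q.lower (proj₁ (P.within s∈P))
                        , x≤y⇒x≤y⊔z Q.upper (proj₂ (P.within s∈P)))
               , (λ s∈Q → x≤y⇒z⊓x≤y P.lower (proj₁ (Q.within s∈Q))
                        , x≤y⇒x≤z⊔y P.upper (proj₂ (Q.within s∈Q))) ]′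
    }
    where
    module P = Bounds p
    module Q = Bounds q

  bounds-⋃ : ∀ {k} {Q : Fin k → ℝ → Set} → (∀ i → Bounds (Q i)) → Bounds (λ s → ∃ λ i → Q i s)
  bounds-⋃ {zero}  _ = bounds-∅ λ { (() , _) }
  bounds-⋃ {suc k} {Q} b = bounds-⊆ split (bounds-∪ (b zero) (bounds-⋃ (λ i → b (suc i))))
    where
    split : ∀ {s} → ∃ (λ i → Q i s) → Q zero s ⊎ ∃ (λ i → Q (suc i) s)
    split (zero  , q) = inj₁ q
    split (suc i , q) = inj₂ (i , q)

  bounds-subsingleton : ExcludedMiddle 0ℓ → ∀ {Q} → (∀ {s} → Q s → 0ℝ < s) →
                        (∀ {s t} → Q s → Q t → s ≡ t) → Bounds Q
  bounds-subsingleton em {Q} Q-pos Q-unique with em {∃ Q}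
  ... | yes (t , q) = bounds-singleton (Q-pos q) (λ q′ → Q-unique q′ q)
  ... | no Q-empty  = bounds-∅ λ q → Q-empty (_ , q)

module Walks (RF : RealField) where
  open OrderedField RF
  open Structures RF

  Label : Str → ℝ → Set
  Label A s = ∃₂ λ x y → rel A s x y

  infixr 5 _∷_
  data Walk (A : Str) : Fin (size A) → Fin (size A) → Set where
    []  : ∀ {x} → Walk A x x
    _∷_ : ∀ {c x y z} → rel A c x y → Walk A y z → Walk A x z

  module _ {A : Str} where

    weight : ∀ {x y} → Walk A x y → ℝ
    weight []               = 0ℝ
    weight (_∷_ {c} _ w)    = c + weight w

    length : ∀ {x y} → Walk A x y → ℕ
    length []      = 0
    length (_ ∷ w) = suc (length w)

    vertices : ∀ {x y} → Walk A x y → List (Fin (size A))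
    vertices {x} []      = x ∷ []
    vertices {x} (_ ∷ w) = x ∷ vertices w

    length-vertices : ∀ {x y} (w : Walk A x y) → List.length (vertices w) ≡ suc (length w)
    length-vertices []      = refl
    length-vertices (_ ∷ w) = cong suc (length-vertices w)

    first∈vertices : ∀ {x y} (w : Walk A x y) → x ∈ vertices w
    first∈vertices []      = here refl
    first∈vertices (_ ∷ _) = here refl

    last∈vertices : ∀ {x y} (w : Walk A x y) → y ∈ vertices w
    last∈vertices []      = here refl
    last∈vertices (_ ∷ w) = there (last∈vertices w)

    weight-nonneg : ∀ {x y} (w : Walk A x y) → 0ℝ ≤ weight w
    weight-nonneg []      = ≤-refl
    weight-nonneg (e ∷ w) = ≤-trans (inj₁ (rel-pos A e)) (x≤x+y (weight-nonneg w))

    length·≤weight : ∀ {m} → (∀ {c x y} → rel A c x y → m ≤ c) →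
                     ∀ {x y} (w : Walk A x y) → length w · m ≤ weight w
    length·≤weight m≤label []      = ≤-refl
    length·≤weight m≤label (e ∷ w) = +-mono-≤ (m≤label e) (length·≤weight m≤label w)

    infixr 5 _++_
    _++_ : ∀ {x y z} → Walk A x y → Walk A y z → Walk A x z
    []      ++ v = v
    (e ∷ w) ++ v = e ∷ (w ++ v)

    weight-++ : ∀ {x y z} (w : Walk A x y) (v : Walk A y z) → weight (w ++ v) ≡ weight w + weight v
    weight-++ []            v = sym (+-identityˡ (weight v))
    weight-++ (_∷_ {c} _ w) v =
      trans (cong (c +_) (weight-++ w v)) (sym (+-assoc c (weight w) (weight v)))

    module _ (symmetric : ∀ {c x y} → rel A c x y → rel A c y x) where

      reverse : ∀ {x y} → Walk A x y → Walk A y x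
      reverse []      = []
      reverse (e ∷ w) = reverse w ++ (symmetric e ∷ [])

      weight-reverse : ∀ {x y} (w : Walk A x y) → weight (reverse w) ≡ weight w
      weight-reverse []            = refl
      weight-reverse (_∷_ {c} e w) = begin
        weight (reverse w ++ (symmetric e ∷ []))  ≡⟨ weight-++ (reverse w) (symmetric e ∷ []) ⟩
        weight (reverse w) + (c + 0ℝ)             ≡⟨ cong₂ _+_ (weight-reverse w) (+-identityʳ c) ⟩
        weight w + c                              ≡⟨ +-comm (weight w) c ⟩
        c + weight w                              ∎
        where open ≡-Reasoning

  module _ {A B : Str} {f : Fin (size A) → Fin (size B)} (f-hom : IsHom A B f) where

    map : ∀ {x y} → Walk A x y → Walk B (f x) (f y)
    map []      = []
    map (e ∷ w) = f-hom e ∷ map w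

    weight-map : ∀ {x y} (w : Walk A x y) → weight (map w) ≡ weight w
    weight-map []            = refl
    weight-map (_∷_ {c} _ w) = cong (c +_) (weight-map w)

  lift : ∀ {C : Str} {k} {ι : Fin k → Fin (size C)} → Injective _≡_ _≡_ ι →
         ∀ {x y} (w : Walk C x y) → (∀ {z} → z ∈ vertices w → ∃ λ i → ι i ≡ z) →
         ∀ {i j} → ι i ≡ x → ι j ≡ y → Σ (Walk (Induced C ι) i j) λ w′ → weight w′ ≡ weight w
  lift ι-injective [] _ ιi≡x ιj≡x with ι-injective (trans ιi≡x (sym ιj≡x))
  ... | refl = [] , refl
  lift {C} ι-injective (_∷_ {c} e w) in-image ιi≡x ιj≡z with in-image (there (first∈vertices w))
  ... | i′ , ιi′≡y with lift ι-injective w (in-image ∘ there) ιi′≡y ιj≡z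
  ...   | w′ , weight-w′ = subst₂ (rel C c) (sym ιi≡x) (sym ιi′≡y) e ∷ w′ , cong (c +_) weight-w′

  metric-walk-bound : ∀ {X} → IsMetric X → ∀ {x y} (w : Walk X x y) →
                      x ≡ y ⊎ ∃ λ c → rel X c x y × c ≤ weight w
  metric-walk-bound _ [] = inj₁ refl
  metric-walk-bound X-metric {x} {z} (_∷_ {c} e w) with metric-walk-bound X-metric w
  ... | inj₁ refl = inj₂ (c , e , x≤x+y (weight-nonneg w))
  ... | inj₂ (c′ , e′ , c′≤w) with x Fin.≟ z
  ...   | yes x≡z = inj₁ x≡z
  ...   | no x≢z with proj₁ (proj₂ X-metric) x z x≢z
  ...     | c″ , e″ = inj₂ (c″ , e″ , ≤-trans (proj₂ (proj₂ X-metric) e e′ e″) (+-monoˡ-≤ c c′≤w))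

  irreflexive-metric : ∀ {X} → IsMetric X → ∀ {c x} → ¬ rel X c x x
  irreflexive-metric X-metric = proj₁ (proj₂ (proj₁ X-metric))

  functional-metric : ∀ {X} → IsMetric X → ∀ {s t x y} → rel X s x y → rel X t x y → s ≡ t
  functional-metric X-metric = proj₂ (proj₂ (proj₁ X-metric))

  hom-into-metric⇒edge≤weight : ∀ {A X f} → IsMetric X → IsHom A X f →
                                ∀ {a x y} → rel A a x y → (w : Walk A x y) → a ≤ weight w
  hom-into-metric⇒edge≤weight {A} {X} {f} X-metric f-hom {a} {x} e w
    with metric-walk-bound X-metric (map {A} {X} f-hom w)
  ... | inj₁ fx≡fy =
    contradiction (subst (rel X a (f x)) (sym fx≡fy) (f-hom e)) (irreflexive-metric {X} X-metric)
  ... | inj₂ (c , e′ , c≤fw) = subst₂ _≤_ (functional-metric {X} X-metric e′ (f-hom e))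
                                          (weight-map {A} {X} f-hom w) c≤fw

module EdgesBelowWalks (RF : RealField) where
  open OrderedField RF
  open Structures RF
  open Walks RF

  SmallSubstructuresCompletable : ℕ → Str → Set₁
  SmallSubstructuresCompletable n C =
    ∀ k (ι : Fin k → Fin (size C)) → Injective _≡_ _≡_ ι → k ≤ℕ n →
    Σ Str λ C′ → IsMetric C′ × Completion (Induced C ι) C′

  -- the vertices of a short walk span a small substructure, whose metric completion bounds the edge
  edge≤short-walk : ∀ {n C} → SmallSubstructuresCompletable n C →
                    ∀ {a x y} → rel C a x y → (w : Walk C x y) → length w <ℕ n → a ≤ weight w
  edge≤short-walk {n} {C} small {a} e w short = bound (small (List.length L) ι ι-injective k≤n)
    where
    L = deduplicate Fin._≟_ (vertices w)
    ι = lookup L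
    ι-injective : Injective _≡_ _≡_ ι
    ι-injective = lookup-injective (deduplicate-! Fin._≟_ (vertices w))
    k≤n : List.length L ≤ℕ n
    k≤n = ℕ.≤-trans (length-deduplicate Fin._≟_ (vertices w))
                    (subst (_≤ℕ n) (sym (length-vertices w)) short)
    in-image : ∀ {z} → z ∈ vertices w → ∃ λ i → ι i ≡ z
    in-image z∈w = let z∈L = ∈-deduplicate⁺ Fin._≟_ z∈w in index z∈L , sym (lookup-index z∈L)
    bound : Σ Str (λ X → IsMetric X × Completion (Induced C ι) X) → a ≤ weight w
    bound (X , X-metric , f , f-hom , _)
      with in-image (first∈vertices w) | in-image (last∈vertices w)
    ... | i , ιi≡x | j , ιj≡y with lift ι-injective w in-image ιi≡x ιj≡y
    ... | w′ , weight-w′ = subst (a ≤_) weight-w′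
      (hom-into-metric⇒edge≤weight {Induced C ι} {X} X-metric f-hom
        (subst₂ (rel C a) (sym ιi≡x) (sym ιj≡y) e) w′)

  edge≤walk : ∀ {n C} → (labels : Bounds (Label C)) → Bounds.upper labels ≤ n · Bounds.lower labels →
              SmallSubstructuresCompletable n C →
              ∀ {a x y} → rel C a x y → (w : Walk C x y) → a ≤ weight w
  edge≤walk {n} labels upper≤n·lower small {a} {x} {y} e w with ℕ.≤-<-connex n (length w)
  ... | inj₂ short = edge≤short-walk small e w short
  ... | inj₁ long  = begin
    a                  ≤⟨ proj₂ (within (x , y , e)) ⟩
    upper              ≤⟨ upper≤n·lower ⟩
    n · lower          ≤⟨ ·-monoˡ-≤ (inj₁ lower-pos) long ⟩
    length w · lower   ≤⟨ length·≤weight (λ e′ → proj₁ (within (_ , _ , e′))) w ⟩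
    weight w           ∎
    where
    open Bounds labels
    open import Relation.Binary.Reasoning.StrictPartialOrder strictPartialOrder

module DistanceStructures (RF : RealField) where
  open OrderedField RF
  open Structures RF

  fromDistance : ∀ n (d : Fin n → Fin n → ℝ) → (∀ {x y} → x ≢ y → 0ℝ < d x y) → Str
  fromDistance n d d-pos = mkStr n (λ s x y → x ≢ y × s ≡ d x y) λ { (x≢y , refl) → d-pos x≢y }

  fromDistance-isMetric : ∀ {n d} (d-pos : ∀ {x y} → x ≢ y → 0ℝ < d x y) →
                          (∀ x y → d x y ≡ d y x) → (∀ x y z → d x z ≤ d x y + d y z) →
                          IsMetric (fromDistance n d d-pos)
  fromDistance-isMetric {d = d} _ d-sym d-triangle =
      ( (λ { (x≢y , refl) → x≢y ∘ sym , d-sym _ _ })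
      , (λ { (x≢x , _) → x≢x refl })
      , (λ { (_ , refl) (_ , refl) → refl }) )
    , (λ x y x≢y → d x y , x≢y , refl)
    , λ { {x = x} {y} {z} (_ , refl) (_ , refl) (_ , refl) → d-triangle x y z }

module ShortestPath (RF : RealField) where
  open OrderedField RF
  open Structures RF
  open Walks RF
  open DistanceStructures RF

  module _ (C : Str) (labels : Bounds (Label C))
           (symmetric : ∀ {c x y} → rel C c x y → rel C c y x)
           (irreflexive : ∀ {c x} → ¬ rel C c x x)
           (edge≤walk : ∀ {a x y} → rel C a x y → (w : Walk C x y) → a ≤ weight w)
           where
    open Bounds labels

    -- joining every pair of vertices by an edge of label `upper` makes the set of walks nonempty
    -- without shortening any edge of C, since walks through a new edge weigh at least `upper`
    C⁺ : Str
    C⁺ = mkStr (size C) (λ s x y → rel C s x y ⊎ s ≡ upper)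
               λ { (inj₁ e) → rel-pos C e ; (inj₂ refl) → <-≤-trans lower-pos lower≤upper }

    symmetric⁺ : ∀ {c x y} → rel C⁺ c x y → rel C⁺ c y x
    symmetric⁺ (inj₁ e) = inj₁ (symmetric e)
    symmetric⁺ (inj₂ c≡upper) = inj₂ c≡upper

    lower≤label⁺ : ∀ {c x y} → rel C⁺ c x y → lower ≤ c
    lower≤label⁺ (inj₁ e) = proj₁ (within (_ , _ , e))
    lower≤label⁺ (inj₂ refl) = lower≤upper

    long-or-walk : ∀ {x y} (w : Walk C⁺ x y) →
                   upper ≤ weight w ⊎ Σ (Walk C x y) λ v → weight v ≡ weight w
    long-or-walk [] = inj₂ ([] , refl)
    long-or-walk (inj₂ refl ∷ w) = inj₁ (x≤x+y (weight-nonneg w))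
    long-or-walk (_∷_ {c} (inj₁ e) w) with long-or-walk w
    ... | inj₁ upper≤w     = inj₁ (≤-trans upper≤w (y≤x+y (inj₁ (rel-pos C e))))
    ... | inj₂ (v , v≡w)   = inj₂ (e ∷ v , cong (c +_) v≡w)

    distance : ∀ x y → ∃ (IsInfimum (weight {C⁺} {x} {y}))
    distance x y = infimum weight (0ℝ , weight-nonneg) (inj₂ refl ∷ [])

    d : Fin (size C) → Fin (size C) → ℝ
    d x y = proj₁ (distance x y)

    d≤weight : ∀ {x y} (w : Walk C⁺ x y) → d x y ≤ weight w
    d≤weight {x} {y} = proj₁ (proj₂ (distance x y))

    ≤d : ∀ {x y b} → (∀ (w : Walk C⁺ x y) → b ≤ weight w) → b ≤ d x y
    ≤d {x} {y} {b} = proj₂ (proj₂ (distance x y)) b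

    d-edge : ∀ {a x y} → rel C a x y → d x y ≡ a
    d-edge {a} e = ≤-antisym (subst (d _ _ ≤_) (+-identityʳ a) (d≤weight (inj₁ e ∷ []))) (≤d a≤weight)
      where
      a≤weight : ∀ w → a ≤ weight w
      a≤weight w with long-or-walk w
      ... | inj₁ upper≤w     = ≤-trans (proj₂ (within (_ , _ , e))) upper≤w
      ... | inj₂ (v , v≡w)   = subst (a ≤_) v≡w (edge≤walk e v)

    d-pos : ∀ {x y} → x ≢ y → 0ℝ < d x y
    d-pos {x} {y} x≢y = <-≤-trans lower-pos (≤d lower≤weight)
      where
      lower≤weight : ∀ w → lower ≤ weight w
      lower≤weight []      = contradiction refl x≢y
      lower≤weight (e ∷ w) = ≤-trans (lower≤label⁺ e) (x≤x+y (weight-nonneg w))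

    d-sym : ∀ x y → d x y ≡ d y x
    d-sym x y = ≤-antisym (d≤d-flip x y) (d≤d-flip y x)
      where
      d≤d-flip : ∀ x y → d x y ≤ d y x
      d≤d-flip x y =
        ≤d λ w → subst (d x y ≤_) (weight-reverse symmetric⁺ w) (d≤weight (reverse symmetric⁺ w))

    d-triangle : ∀ x y z → d x z ≤ d x y + d y z
    d-triangle x y z = infimum-+ (proj₂ (distance x y)) (proj₂ (distance y z))
      λ w v → subst (d x z ≤_) (weight-++ w v) (d≤weight (w ++ v))

    metric-completion : Σ Str λ C′ → IsMetric C′ × StrongCompletion C C′
    metric-completion =
      C′ , fromDistance-isMetric d-pos d-sym d-triangle , (λ x → x) , (hom , embedding) , (λ eq → eq)
      where
      C′ = fromDistance (size C) d d-pos
      hom : IsHom C C′ (λ x → x)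
      hom e = (λ { refl → irreflexive e }) , sym (d-edge e)
      reflect : ∀ {s t x y} → rel C′ s x y → rel C t x y → rel C s x y
      reflect (_ , s≡d) e = subst (λ s → rel C s _ _) (sym (trans s≡d (d-edge e))) e
      reflect-pair : ∀ {s x y} → (∃ λ t → rel C t x y ⊎ rel C t y x) → rel C′ s x y → rel C s x y
      reflect-pair (_ , inj₁ e) e′ = reflect e′ e
      reflect-pair (_ , inj₂ e) e′ = reflect e′ (symmetric e)
      embedding : ∀ D → Irreducible C D → (∀ x y → D x → D y → x ≡ y → x ≡ y)
                                         × (∀ {s x y} → D x → D y → rel C′ s x y → rel C s x y)
      embedding D D-irr =
        (λ _ _ _ _ eq → eq) , λ {_} {x} {y} Dx Dy e′ → reflect-pair (D-irr x y Dx Dy (proj₁ e′)) e′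

module LabelledGraphs (RF : RealField) where
  open OrderedField RF
  open Structures RF
  open Walks RF

  labels-bounded : ExcludedMiddle 0ℓ → ∀ {B} → IsEdgeLabelled B → Bounds (Label B)
  labels-bounded em {B} (_ , _ , functional) =
    bounds-⋃ λ _ → bounds-⋃ λ _ → bounds-subsingleton em (rel-pos B) functional

  pair-irreducible : ∀ {C c x y} → rel C c x y → Irreducible C (λ z → z ≡ x ⊎ z ≡ y)
  pair-irreducible         _ _ _ (inj₁ refl) (inj₁ refl) x≢x = contradiction refl x≢x
  pair-irreducible {c = c} e _ _ (inj₁ refl) (inj₂ refl) _   = c , inj₁ e
  pair-irreducible {c = c} e _ _ (inj₂ refl) (inj₁ refl) _   = c , inj₂ e
  pair-irreducible         _ _ _ (inj₂ refl) (inj₂ refl) y≢y = contradiction refl y≢y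

  labels-covered : ∀ {B C} →
                   (∀ D → Irreducible C D → ∃ λ f → IsEmb B C f × (∀ x → D x → ∃ λ b → f b ≡ x)) →
                   ∀ {s} → Label C s → Label B s
  labels-covered {C = C} cover (x , y , e) with cover _ (pair-irreducible {C} e)
  ... | f , (_ , _ , f-reflects) , onto with onto x (inj₁ refl) | onto y (inj₂ refl)
  ...   | b , refl | b′ , refl = b , b′ , f-reflects e

  symmetric-pullback : ∀ {C C₀ g} → IsHomEmb C C₀ g → (∀ {s x y} → rel C₀ s x y → rel C₀ s y x) →
                       ∀ {s x y} → rel C s x y → rel C s y x
  symmetric-pullback {C} (g-hom , g-emb) symmetric₀ e =
    proj₂ (g-emb _ (pair-irreducible {C} e)) (inj₂ refl) (inj₁ refl) (symmetric₀ (g-hom e))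

lemma6p22 : (RF : RealField) → ExcludedMiddle 0ℓ →
    Structures.StrongLocallyFiniteSubclass RF (Structures.IsMetric RF) (Structures.IsEdgeLabelled RF)
lemma6p22 RF em = (λ _ → proj₁) , λ B B-metric C₀ (symmetric₀ , irreflexive₀ , _) →
  let labelsB = labels-bounded em {B} (proj₁ B-metric)
      n , upper≤n·lower = archimedean em (Bounds.upper labelsB) (Bounds.lower-pos labelsB)
  in n , λ C cover (g , g-homEmb) small →
    let labelsC = bounds-⊆ (labels-covered {B} {C} cover) labelsB
    in metric-completion C labelsC (symmetric-pullback {C} {C₀} g-homEmb symmetric₀)
         (λ e → irreflexive₀ (proj₁ g-homEmb e)) (edge≤walk labelsC upper≤n·lower small)
  where
  open OrderedField RF
  open EdgesBelowWalks RF
  open ShortestPath RF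
  open LabelledGraphs RF
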